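{- Let $n=6$, $r=9$, $\mathcal{W}=(\mathbb{Z}/6\mathbb{Z})\wr S_9$ acting on $X=(\mathbb{Z}/6\mathbb{Z})\times\{1,\ldots,9\}$. For $0\le j\le 4$ let $\gamma_j=\left(\prod_{i=1}^{9-2j}\rho_i^3\right)\left(\prod_{i=0}^{j-1}\tau_{8-2i,9-2i}\right)$ and $A_j=\langle\gamma_j\rangle$; let $B_0=\langle\rho_1^3\rho_2^3\rangle$, $B_1=\langle\tau_{1,2}\rangle$, $C=\langle\rho_1^3\rangle$, $D=\langle\rho_1^2\rangle$, $E=\langle\rho_1\rangle$. Then every subgroup of $\mathcal{W}$ generated by an element of cycle type $(2,27)$ is conjugate to some $A_j$; every subgroup generated by an element of cycle type $(2,6)$ is conjugate to $B_0$ or $B_1$; and every subgroup generated by an element of cycle type $(2,3)$, $(3,2)$, $(6,1)$ is conjugate to $C$, $D$, $E$, respectively.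
   Context: For positive integers $n,r$: $A_0=\mathbb{Z}/n\mathbb{Z}$, $\Omega=\{1,\ldots,r\}$, $S_r$ the symmetric group on $\Omega$, $A_0^r$ the functions $\Omega\to A_0$ under pointwise addition, $g_\pi(i)=g(\pi^{ -1}(i))$; the wreath product $A_0\wr S_r$ is the set of pairs $(f,\pi)$ with $(f,\pi)(g,\sigma)=(f+g_\pi,\pi\sigma)$, acting on $A_0\times\Omega$ by $(f,\pi)(a,i)=(f(\pi(i))+a,\pi(i))$. $\rho_i=(\delta_i,1)$ where $\delta_i(i)=1$, $\delta_i(j)=0$ for $j\ne i$; $\tau_{i,j}=(e,(i,j))$ with $e$ the zero function and $(i,j)\in S_r$ a transposition. An element has cycle type $(a,b)$ on $X$ if its disjoint cycle decomposition, disregarding $1$-cycles, is a product of $b$ cycles of length $a$. -}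

module Defs where

open import Data.Nat using (ℕ; zero; suc; _+_; _*_; _∸_; _≤_; _<_; NonZero)
open import Data.Nat.DivMod using (_mod_)
open import Data.Fin using (Fin; toℕ; _≟_)
open import Data.Fin.Permutation using (Permutation′; _⟨$⟩ʳ_; _⟨$⟩ˡ_; _∘ₚ_; transpose; flip)
import Data.Fin.Permutation as Perm
open import Data.Product using (Σ; _×_; _,_; ∃; ∃-syntax; proj₁; proj₂)
open import Data.Product.Properties using (≡-dec)
open import Data.List using (List; []; _∷_; foldr; map; filter; length; upTo; allFin; cartesianProduct)
open import Relation.Binary.PropositionalEquality using (_≡_)
open import Relation.Nullary using (¬_; ¬?)

module _ {n : ℕ} {{_ : NonZero n}} where

  _⊕_ : Fin n → Fin n → Fin n
  a ⊕ b = (toℕ a + toℕ b) mod n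

  ⊖_ : Fin n → Fin n
  ⊖ a = (n ∸ toℕ a) mod n

  zeroZ : Fin n
  zeroZ = 0 mod n

  oneZ : Fin n
  oneZ = 1 mod n

-- The wreath product A₀ ≀ S_r : pairs (f , π) with f : Ω → A₀,
-- π a permutation of Ω = Fin r (point i of Fin r is the paper's i+1).

record W (n r : ℕ) : Set where
  constructor ⟨_,_⟩
  field
    fun  : Fin r → Fin n
    perm : Permutation′ r
open W public

module _ {n r : ℕ} {{_ : NonZero n}} where

  _≈W_ : W n r → W n r → Set
  x ≈W y = (∀ i → fun x i ≡ fun y i) × (∀ i → perm x ⟨$⟩ʳ i ≡ perm y ⟨$⟩ʳ i)

  twist : (Fin r → Fin n) → Permutation′ r → (Fin r → Fin n)
  twist g π i = g (π ⟨$⟩ˡ i)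

  -- (f , π)(g , σ) = (f + g_π , πσ)   (πσ means: first σ, then π)
  _·_ : W n r → W n r → W n r
  ⟨ f , π ⟩ · ⟨ g , σ ⟩ = ⟨ (λ i → f i ⊕ twist g π i) , σ ∘ₚ π ⟩

  one : W n r
  one = ⟨ (λ _ → zeroZ) , Perm.id ⟩

  inv : W n r → W n r
  inv ⟨ f , π ⟩ = ⟨ (λ i → ⊖ f (π ⟨$⟩ʳ i)) , flip π ⟩

  _^_ : W n r → ℕ → W n r
  w ^ zero = one
  w ^ suc k = w · (w ^ k)

  prodW : List (W n r) → W n r
  prodW = foldr _·_ one

  ρ : Fin r → W n r
  ρ i = ⟨ (λ j → δ i j) , Perm.id ⟩
    where
    δ : Fin r → Fin r → Fin n
    δ i j with i ≟ j
    ... | Relation.Nullary.yes _ = oneZ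
    ... | Relation.Nullary.no _ = zeroZ

  τ : Fin r → Fin r → W n r
  τ i j = ⟨ (λ _ → zeroZ) , transpose i j ⟩

  X : Set
  X = Fin n × Fin r

  act : W n r → X → X
  act ⟨ f , π ⟩ (a , i) = (f (π ⟨$⟩ʳ i) ⊕ a , π ⟨$⟩ʳ i)

  allX : List X
  allX = cartesianProduct (allFin n) (allFin r)

  _≟X_ : (x y : X) → Relation.Nullary.Dec (x ≡ y)
  _≟X_ = ≡-dec _≟_ _≟_

  movedCount : W n r → ℕ
  movedCount w = length (filter (λ x → ¬? (act w x ≟X x)) allX)

  -- w has cycle type (a , b) on X: disregarding 1-cycles (fixed points),
  -- its disjoint cycle decomposition consists of b cycles of length a.  So: a ≥ 2, every moved point lies on a cycle of length
  -- exactly a, and the moved points (= union of the nontrivial cycles)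
  -- number a * b.
  CycleLength : W n r → X → ℕ → Set
  CycleLength w x k = (1 ≤ k) × (act (w ^ k) x ≡ x)
                      × (∀ m → 1 ≤ m → m < k → ¬ (act (w ^ m) x ≡ x))

  HasCycleType : W n r → ℕ → ℕ → Set
  HasCycleType w a b = (2 ≤ a)
                     × (∀ x → ¬ (act w x ≡ x) → CycleLength w x a)
                     × (movedCount w ≡ a * b)

  -- x ∈ ⟨ g ⟩   (in a finite group the powers g^k, k ∈ ℕ, exhaust ⟨g⟩)
  _∈⟨_⟩ : W n r → W n r → Set
  x ∈⟨ g ⟩ = ∃[ k ] ((g ^ k) ≈W x)

  conj : W n r → W n r → W n r
  conj h x = (h · x) · inv h

  ConjugateCyclic : W n r → W n r → Set
  ConjugateCyclic g g' = ∃[ h ] ((∀ x → x ∈⟨ g ⟩ → conj h x ∈⟨ g' ⟩)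
                                × (∀ y → y ∈⟨ g' ⟩ → ∃[ x ] (x ∈⟨ g ⟩ × conj h x ≈W y)))

𝒲 : Set
𝒲 = W 6 9

-- paper's point i ∈ {1,…,9} as an element of Fin 9
pt : ℕ → Fin 9
pt i = (i ∸ 1) mod 9

γ : Fin 5 → 𝒲
γ j = prodW (map (λ i → ρ (pt (suc i)) ^ 3) (upTo (9 ∸ 2 * toℕ j)))
    · prodW (map (λ i → τ (pt (8 ∸ 2 * i)) (pt (9 ∸ 2 * i))) (upTo (toℕ j)))

b₀ b₁ c d e : 𝒲
b₀ = (ρ (pt 1) ^ 3) · (ρ (pt 2) ^ 3)
b₁ = τ (pt 1) (pt 2)
c  = ρ (pt 1) ^ 3
d  = ρ (pt 1) ^ 2
e  = ρ (pt 1)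

{-# OPTIONS --safe #-}
module Submission where

-- An element w = (f , π) fixes a point (a , i) iff it fixes the whole block A₀ × {i}, i.e. iff
-- π i = i and f i = 0, so the number of moved points is 6 times the number of moved blocks and
-- the cycle types (2,27), (2,6), (2,3), (3,2), (6,1) mean that 9, 2, 1, 1, 1 blocks move.
--
-- If w has order 2, then π is an involution and f i + f (π i) = 0.  Conjugating by an element
-- (k , 1) clears f on every 2-cycle of π, and on a moved block fixed by π the value of f has order
-- 2, so it is 3.  Conjugating further by a permutation brings π into the form
-- τ_{8,9} τ_{6,7} ⋯ (greedily, one 2-cycle at a time), which yields γ_j, and for two moved blocks
-- b₀ or b₁.  A single moved block is fixed by π; moving it to block 1 turns w into ρ₁ᵛ, where v
-- has order 2, 3 or 6 and so generates the same subgroup of ℤ/6 as 3, 2 or 1.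

open import Defs
open import Data.Fin using (Fin; #_; toℕ; fromℕ<; _≟_; _<_; _<?_) renaming (zero to fz; suc to fs)
import Data.Fin.Properties as FP
open import Data.Nat as ℕ using (ℕ; zero; suc; NonZero)
import Data.Nat.Properties as NP
open import Data.Nat.DivMod using (_%_; _mod_; %-distribˡ-+; m%n%n≡m%n; m<n⇒m%n≡m; n%n≡0)
open import Data.Fin.Permutation using (Permutation′; _⟨$⟩ʳ_; _⟨$⟩ˡ_; _∘ₚ_; inverseˡ; inverseʳ; transpose)
import Data.Fin.Permutation as Perm
open import Data.Bool using (if_then_else_)
open import Data.Product using (Σ-syntax; _×_; _,_; proj₁; proj₂)
open import Data.Product.Properties using (,-injectiveˡ; ,-injectiveʳ)
open import Data.List using ([]; _∷_; _++_; map; filter; length; allFin; cartesianProduct)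
import Data.List.Properties as LP
open import Data.List.Membership.Propositional using (_∈_)
open import Data.List.Membership.Propositional.Properties using (∈-filter⁺; ∈-filter⁻; ∈-allFin)
open import Data.List.Relation.Unary.Any using (here; there)
open import Data.List.Relation.Unary.AllPairs using (_∷_)
open import Data.List.Relation.Unary.All using (_∷_; [])
open import Data.List.Relation.Unary.Unique.Propositional using (Unique)
import Data.List.Relation.Unary.Unique.Propositional.Properties as Unique
open import Algebra.Bundles.Raw using (RawMonoid)
import Algebra.Definitions.RawMonoid as RawMonoidDefinitions
open import Data.Sum using (_⊎_; inj₁; inj₂; [_,_]′)
open import Function using (id; _∘_)
open import Function.Bundles using (_⇔_; Equivalence; mk⇔)
open import Relation.Binary.Definitions using (tri<; tri≈; tri>)
open import Relation.Nullary using (Dec; yes; no; ¬_; ¬?; contradiction)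
open import Relation.Nullary.Decidable
  using (map′; True; toWitness; _×-dec_; _⊎-dec_; _→-dec_; from-yes; does; dec-true; dec-false; decidable-stable)
open import Relation.Unary using (Decidable)
open import Relation.Binary.Bundles using (Setoid)
import Relation.Binary.Reasoning.Setoid as SetoidReasoning
open import Relation.Binary.PropositionalEquality

module Permutations {r : ℕ} where

  ⟨$⟩ʳ-injective : ∀ (σ : Permutation′ r) {i j} → σ ⟨$⟩ʳ i ≡ σ ⟨$⟩ʳ j → i ≡ j
  ⟨$⟩ʳ-injective σ {i} {j} σi≡σj = trans (sym (inverseˡ σ)) (trans (cong (σ ⟨$⟩ˡ_) σi≡σj) (inverseˡ σ))

  transpose-matchˡ : ∀ (i j : Fin r) → transpose i j ⟨$⟩ʳ i ≡ j
  transpose-matchˡ i j rewrite dec-true (i ≟ i) refl = refl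

  transpose-matchʳ : ∀ (i j : Fin r) → transpose i j ⟨$⟩ʳ j ≡ i
  transpose-matchʳ i j with j ≟ i
  ... | yes j≡i = j≡i
  ... | no _ rewrite dec-true (j ≟ j) refl = refl

  transpose-involutive : ∀ (i j k : Fin r) → transpose i j ⟨$⟩ʳ (transpose i j ⟨$⟩ʳ k) ≡ k
  transpose-involutive i j k with k ≟ i
  ... | yes refl = transpose-matchʳ k j
  ... | no k≢i with k ≟ j
  ...   | yes refl = transpose-matchˡ i k
  ...   | no k≢j rewrite dec-false (k ≟ i) k≢i | dec-false (k ≟ j) k≢j = refl

  transpose-mismatch : ∀ (i j k : Fin r) → k ≢ i → k ≢ j → transpose i j ⟨$⟩ʳ k ≡ k
  transpose-mismatch i j k k≢i k≢j rewrite dec-false (k ≟ i) k≢i | dec-false (k ≟ j) k≢j = refl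

  two-point : ∀ {i₀ i₁ j₀ j₁ : Fin r} → i₀ ≢ i₁ → j₀ ≢ j₁ →
              Σ[ σ ∈ Permutation′ r ] σ ⟨$⟩ʳ i₀ ≡ j₀ × σ ⟨$⟩ʳ i₁ ≡ j₁
  two-point {i₀} {i₁} {j₀} {j₁} i₀≢i₁ j₀≢j₁ = τ₀ ∘ₚ τ₁ , σi₀≡j₀ , transpose-matchˡ (τ₀ ⟨$⟩ʳ i₁) j₁
    where
    τ₀ = transpose i₀ j₀
    τ₁ = transpose (τ₀ ⟨$⟩ʳ i₁) j₁
    σi₀≡j₀ : τ₁ ⟨$⟩ʳ (τ₀ ⟨$⟩ʳ i₀) ≡ j₀
    σi₀≡j₀ = trans (cong (τ₁ ⟨$⟩ʳ_) (transpose-matchˡ i₀ j₀))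
                   (transpose-mismatch (τ₀ ⟨$⟩ʳ i₁) j₁ j₀
                     (λ j₀≡τ₀i₁ → i₀≢i₁ (⟨$⟩ʳ-injective τ₀ (trans (transpose-matchˡ i₀ j₀) j₀≡τ₀i₁))) j₀≢j₁)

module Counting where

  module _ {A B : Set} {P : A × B → Set} {Q : B → Set} (P? : Decidable P) (Q? : Decidable Q)
           (P⇔Q : ∀ a b → P (a , b) ⇔ Q b) where

    length-filter-map-pair : ∀ a ys → length (filter P? (map (a ,_) ys)) ≡ length (filter Q? ys)
    length-filter-map-pair a [] = refl
    length-filter-map-pair a (y ∷ ys) with P? (a , y) | Q? y
    ... | yes _  | yes _  = cong suc (length-filter-map-pair a ys)
    ... | yes p  | no ¬q  = contradiction (Equivalence.to (P⇔Q a y) p) ¬q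
    ... | no ¬p  | yes q  = contradiction (Equivalence.from (P⇔Q a y) q) ¬p
    ... | no _   | no _   = length-filter-map-pair a ys

    length-filter-cartesianProduct : ∀ xs ys →
      length (filter P? (cartesianProduct xs ys)) ≡ length xs ℕ.* length (filter Q? ys)
    length-filter-cartesianProduct [] ys = refl
    length-filter-cartesianProduct (x ∷ xs) ys = begin
      length (filter P? (map (x ,_) ys ++ cartesianProduct xs ys))
        ≡⟨ cong length (LP.filter-++ P? (map (x ,_) ys) (cartesianProduct xs ys)) ⟩
      length (filter P? (map (x ,_) ys) ++ filter P? (cartesianProduct xs ys))
        ≡⟨ LP.length-++ (filter P? (map (x ,_) ys)) ⟩
      length (filter P? (map (x ,_) ys)) ℕ.+ length (filter P? (cartesianProduct xs ys))
        ≡⟨ cong₂ ℕ._+_ (length-filter-map-pair x ys) (length-filter-cartesianProduct xs ys) ⟩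
      length (filter Q? ys) ℕ.+ length xs ℕ.* length (filter Q? ys) ∎
      where open ≡-Reasoning

  module _ {m : ℕ} {P : Fin m → Set} (P? : Decidable P) where

    count : ℕ
    count = length (filter P? (allFin m))

    ∈-filter-allFin⁺ : ∀ i → P i → i ∈ filter P? (allFin m)
    ∈-filter-allFin⁺ i = ∈-filter⁺ P? (∈-allFin i)

    ∈-filter-allFin⁻ : ∀ {i} → i ∈ filter P? (allFin m) → P i
    ∈-filter-allFin⁻ i∈ = proj₂ (∈-filter⁻ P? {xs = allFin m} i∈)

    count≡m⇒all : count ≡ m → ∀ i → P i
    count≡m⇒all count≡m i = ∈-filter-allFin⁻ (subst (i ∈_) (sym filter≡allFin) (∈-allFin i))
      where
      filter≡allFin : filter P? (allFin m) ≡ allFin m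
      filter≡allFin = LP.filter-complete P? (trans count≡m (sym (LP.length-tabulate id)))

    count≡1⇒unique : count ≡ 1 → Σ[ i ∈ Fin m ] P i × (∀ j → P j → j ≡ i)
    count≡1⇒unique = go (filter P? (allFin m)) refl
      where
      go : ∀ xs → filter P? (allFin m) ≡ xs → length xs ≡ 1 → Σ[ i ∈ Fin m ] P i × (∀ j → P j → j ≡ i)
      go (i ∷ []) eq _ = i , ∈-filter-allFin⁻ (subst (i ∈_) (sym eq) (here refl)) , only-i
        where
        only-i : ∀ j → P j → j ≡ i
        only-i j Pj with subst (j ∈_) eq (∈-filter-allFin⁺ j Pj)
        ... | here j≡i = j≡i

    count≡2⇒pair : count ≡ 2 →
      Σ[ i ∈ Fin m ] Σ[ i′ ∈ Fin m ] i ≢ i′ × P i × P i′ × (∀ j → P j → j ≡ i ⊎ j ≡ i′)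
    count≡2⇒pair = go (filter P? (allFin m)) refl
      where
      go : ∀ xs → filter P? (allFin m) ≡ xs → length xs ≡ 2 →
           Σ[ i ∈ Fin m ] Σ[ i′ ∈ Fin m ] i ≢ i′ × P i × P i′ × (∀ j → P j → j ≡ i ⊎ j ≡ i′)
      go (i ∷ i′ ∷ []) eq _ = i , i′ , i≢i′ , P-at (here refl) , P-at (there (here refl)) , only-i-i′
        where
        P-at : ∀ {j} → j ∈ i ∷ i′ ∷ [] → P j
        P-at j∈ = ∈-filter-allFin⁻ (subst (_ ∈_) (sym eq) j∈)
        i≢i′ : i ≢ i′
        i≢i′ with subst Unique eq (Unique.filter⁺ P? (Unique.allFin⁺ m))
        ... | (i≢i′ ∷ []) ∷ _ = i≢i′
        only-i-i′ : ∀ j → P j → j ≡ i ⊎ j ≡ i′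
        only-i-i′ j Pj with subst (j ∈_) eq (∈-filter-allFin⁺ j Pj)
        ... | here j≡i = inj₁ j≡i
        ... | there (here j≡i′) = inj₂ j≡i′

module ℤMod {n : ℕ} {{_ : NonZero n}} where

  toℕ-mod : ∀ m → toℕ (m mod n) ≡ m % n
  toℕ-mod m = FP.toℕ-fromℕ< _

  %-absorbˡ : ∀ m k → (m % n ℕ.+ k) % n ≡ (m ℕ.+ k) % n
  %-absorbˡ m k = begin
    (m % n ℕ.+ k) % n           ≡⟨ %-distribˡ-+ (m % n) k n ⟩
    (m % n % n ℕ.+ k % n) % n   ≡⟨ cong (λ x → (x ℕ.+ k % n) % n) (m%n%n≡m%n m n) ⟩
    (m % n ℕ.+ k % n) % n       ≡⟨ %-distribˡ-+ m k n ⟨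
    (m ℕ.+ k) % n               ∎
    where open ≡-Reasoning

  %-absorbʳ : ∀ k m → (k ℕ.+ m % n) % n ≡ (k ℕ.+ m) % n
  %-absorbʳ k m = begin
    (k ℕ.+ m % n) % n ≡⟨ cong (_% n) (NP.+-comm k (m % n)) ⟩
    (m % n ℕ.+ k) % n ≡⟨ %-absorbˡ m k ⟩
    (m ℕ.+ k) % n     ≡⟨ cong (_% n) (NP.+-comm m k) ⟩
    (k ℕ.+ m) % n     ∎
    where open ≡-Reasoning

  toℕ-zeroZ : toℕ (zeroZ {n}) ≡ 0
  toℕ-zeroZ = trans (toℕ-mod 0) (m<n⇒m%n≡m (ℕ.>-nonZero⁻¹ n))

  ⊕-comm : ∀ (a b : Fin n) → a ⊕ b ≡ b ⊕ a
  ⊕-comm a b = cong (_mod n) (NP.+-comm (toℕ a) (toℕ b))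

  ⊕-assoc : ∀ (a b c : Fin n) → (a ⊕ b) ⊕ c ≡ a ⊕ (b ⊕ c)
  ⊕-assoc a b c = FP.toℕ-injective (begin
    toℕ ((a ⊕ b) ⊕ c)                      ≡⟨ toℕ-mod _ ⟩
    (toℕ (a ⊕ b) ℕ.+ toℕ c) % n             ≡⟨ cong (λ x → (x ℕ.+ toℕ c) % n) (toℕ-mod _) ⟩
    ((toℕ a ℕ.+ toℕ b) % n ℕ.+ toℕ c) % n   ≡⟨ %-absorbˡ (toℕ a ℕ.+ toℕ b) (toℕ c) ⟩
    (toℕ a ℕ.+ toℕ b ℕ.+ toℕ c) % n         ≡⟨ cong (_% n) (NP.+-assoc (toℕ a) (toℕ b) (toℕ c)) ⟩
    (toℕ a ℕ.+ (toℕ b ℕ.+ toℕ c)) % n       ≡⟨ %-absorbʳ (toℕ a) (toℕ b ℕ.+ toℕ c) ⟨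
    (toℕ a ℕ.+ (toℕ b ℕ.+ toℕ c) % n) % n   ≡⟨ cong (λ x → (toℕ a ℕ.+ x) % n) (toℕ-mod _) ⟨
    (toℕ a ℕ.+ toℕ (b ⊕ c)) % n             ≡⟨ toℕ-mod _ ⟨
    toℕ (a ⊕ (b ⊕ c))                      ∎)
    where open ≡-Reasoning

  ⊕-identityˡ : ∀ (a : Fin n) → zeroZ ⊕ a ≡ a
  ⊕-identityˡ a = FP.toℕ-injective (begin
    toℕ (zeroZ ⊕ a)                 ≡⟨ toℕ-mod _ ⟩
    (toℕ (zeroZ {n}) ℕ.+ toℕ a) % n ≡⟨ cong (λ x → (x ℕ.+ toℕ a) % n) toℕ-zeroZ ⟩
    toℕ a % n                       ≡⟨ m<n⇒m%n≡m (FP.toℕ<n a) ⟩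
    toℕ a                           ∎)
    where open ≡-Reasoning

  ⊕-identityʳ : ∀ (a : Fin n) → a ⊕ zeroZ ≡ a
  ⊕-identityʳ a = trans (⊕-comm a zeroZ) (⊕-identityˡ a)

  ⊕-inverseʳ : ∀ (a : Fin n) → a ⊕ (⊖ a) ≡ zeroZ
  ⊕-inverseʳ a = FP.toℕ-injective (begin
    toℕ (a ⊕ (⊖ a))                  ≡⟨ toℕ-mod _ ⟩
    (toℕ a ℕ.+ toℕ (⊖ a)) % n        ≡⟨ cong (λ x → (toℕ a ℕ.+ x) % n) (toℕ-mod _) ⟩
    (toℕ a ℕ.+ (n ℕ.∸ toℕ a) % n) % n ≡⟨ %-absorbʳ (toℕ a) (n ℕ.∸ toℕ a) ⟩
    (toℕ a ℕ.+ (n ℕ.∸ toℕ a)) % n    ≡⟨ cong (_% n) (NP.m+[n∸m]≡n (NP.<⇒≤ (FP.toℕ<n a))) ⟩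
    n % n                            ≡⟨ n%n≡0 n ⟩
    0                                ≡⟨ toℕ-zeroZ ⟨
    toℕ (zeroZ {n})                  ∎)
    where open ≡-Reasoning

  ⊕-inverseˡ : ∀ (a : Fin n) → (⊖ a) ⊕ a ≡ zeroZ
  ⊕-inverseˡ a = trans (⊕-comm (⊖ a) a) (⊕-inverseʳ a)

  ⊖-zero : ⊖ zeroZ ≡ zeroZ {n}
  ⊖-zero = trans (sym (⊕-identityˡ (⊖ zeroZ))) (⊕-inverseʳ zeroZ)

  x⊕a≡a⇒x≡0 : ∀ {x a : Fin n} → x ⊕ a ≡ a → x ≡ zeroZ
  x⊕a≡a⇒x≡0 {x} {a} x⊕a≡a = begin
    x                 ≡⟨ ⊕-identityʳ x ⟨
    x ⊕ zeroZ         ≡⟨ cong (x ⊕_) (⊕-inverseʳ a) ⟨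
    x ⊕ (a ⊕ (⊖ a))   ≡⟨ ⊕-assoc x a (⊖ a) ⟨
    (x ⊕ a) ⊕ (⊖ a)   ≡⟨ cong (_⊕ (⊖ a)) x⊕a≡a ⟩
    a ⊕ (⊖ a)         ≡⟨ ⊕-inverseʳ a ⟩
    zeroZ             ∎
    where open ≡-Reasoning

  ℤ-rawMonoid : RawMonoid _ _
  ℤ-rawMonoid = record { Carrier = Fin n ; _≈_ = _≡_ ; _∙_ = _⊕_ ; ε = zeroZ }

  open RawMonoidDefinitions ℤ-rawMonoid public renaming (_×_ to _×ℤ_) using ()

  HasOrder : Fin n → ℕ → Set
  HasOrder v a = a ×ℤ v ≡ zeroZ × (∀ m → 1 ℕ.≤ m → m ℕ.< a → m ×ℤ v ≢ zeroZ)

  hasOrder⇒×≢0 : ∀ {v a} m {1≤m : True (1 ℕ.≤? m)} {m<a : True (m ℕ.<? a)} → HasOrder v a → m ×ℤ v ≢ zeroZ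
  hasOrder⇒×≢0 m {1≤m} {m<a} (_ , minimal) = minimal m (toWitness 1≤m) (toWitness m<a)

  v⊕v≡0⇒hasOrder-2 : ∀ {v} → v ⊕ v ≡ zeroZ → v ≢ zeroZ → HasOrder v 2
  v⊕v≡0⇒hasOrder-2 {v} v⊕v≡0 v≢0 = trans (cong (v ⊕_) (⊕-identityʳ v)) v⊕v≡0 , minimal
    where
    minimal : ∀ m → 1 ℕ.≤ m → m ℕ.< 2 → m ×ℤ v ≢ zeroZ
    minimal 1 _ _ v⊕0≡0 = v≢0 (trans (sym (⊕-identityʳ v)) v⊕0≡0)
    minimal (suc (suc _)) _ (ℕ.s≤s (ℕ.s≤s ()))

module WreathProduct {n r : ℕ} {{_ : NonZero n}} where
  open ℤMod

  infix 4 _≋_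

  -- _≈W_ wrapped in a record, so that its arguments can be inferred.
  record _≋_ (x y : W n r) : Set where
    constructor mk≋
    field unwrap : x ≈W y
  open _≋_ public

  ≋-refl : ∀ {x} → x ≋ x
  ≋-refl = mk≋ ((λ _ → refl) , (λ _ → refl))

  ≋-sym : ∀ {x y} → x ≋ y → y ≋ x
  ≋-sym (mk≋ (p , q)) = mk≋ ((λ i → sym (p i)) , (λ i → sym (q i)))

  ≋-trans : ∀ {x y z} → x ≋ y → y ≋ z → x ≋ z
  ≋-trans (mk≋ (p , q)) (mk≋ (p′ , q′)) = mk≋ ((λ i → trans (p i) (p′ i)) , (λ i → trans (q i) (q′ i)))

  ≋-setoid : Setoid _ _
  ≋-setoid = record
    { Carrier = W n r ; _≈_ = _≋_
    ; isEquivalence = record { refl = ≋-refl ; sym = ≋-sym ; trans = ≋-trans } }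

  _≋?_ : ∀ x y → Dec (x ≋ y)
  x ≋? y = map′ mk≋ unwrap ((FP.all? λ i → fun x i ≟ fun y i) ×-dec (FP.all? λ i → perm x ⟨$⟩ʳ i ≟ perm y ⟨$⟩ʳ i))

  ⟨$⟩ˡ-cong : ∀ (π σ : Permutation′ r) → (∀ i → π ⟨$⟩ʳ i ≡ σ ⟨$⟩ʳ i) → ∀ i → π ⟨$⟩ˡ i ≡ σ ⟨$⟩ˡ i
  ⟨$⟩ˡ-cong π σ π≗σ i = begin
    π ⟨$⟩ˡ i                      ≡⟨ inverseˡ σ ⟨
    σ ⟨$⟩ˡ (σ ⟨$⟩ʳ (π ⟨$⟩ˡ i))     ≡⟨ cong (σ ⟨$⟩ˡ_) (π≗σ _) ⟨
    σ ⟨$⟩ˡ (π ⟨$⟩ʳ (π ⟨$⟩ˡ i))     ≡⟨ cong (σ ⟨$⟩ˡ_) (inverseʳ π) ⟩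
    σ ⟨$⟩ˡ i                      ∎
    where open ≡-Reasoning

  ·-cong : ∀ {x x′ y y′} → x ≋ x′ → y ≋ y′ → x · y ≋ x′ · y′
  ·-cong {⟨ f , π ⟩} {⟨ f′ , π′ ⟩} {⟨ g , σ ⟩} (mk≋ (f≗ , π≗)) (mk≋ (g≗ , σ≗)) = mk≋
    ( (λ i → cong₂ _⊕_ (f≗ i) (trans (cong g (⟨$⟩ˡ-cong π π′ π≗ i)) (g≗ _)))
    , (λ i → trans (cong (π ⟨$⟩ʳ_) (σ≗ i)) (π≗ _)) )

  ·-congˡ : ∀ {x x′} y → x ≋ x′ → x · y ≋ x′ · y
  ·-congˡ y x≋x′ = ·-cong x≋x′ (≋-refl {y})

  ·-congʳ : ∀ x {y y′} → y ≋ y′ → x · y ≋ x · y′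
  ·-congʳ x y≋y′ = ·-cong (≋-refl {x}) y≋y′

  ·-assoc : ∀ x y z → (x · y) · z ≋ x · (y · z)
  ·-assoc ⟨ f , π ⟩ ⟨ g , σ ⟩ ⟨ h , _ ⟩ =
    mk≋ ((λ i → ⊕-assoc (f i) (g (π ⟨$⟩ˡ i)) (h (σ ⟨$⟩ˡ (π ⟨$⟩ˡ i)))) , (λ _ → refl))

  ·-identityˡ : ∀ x → one · x ≋ x
  ·-identityˡ ⟨ f , _ ⟩ = mk≋ ((λ i → ⊕-identityˡ (f i)) , (λ _ → refl))

  ·-identityʳ : ∀ x → x · one ≋ x
  ·-identityʳ ⟨ f , _ ⟩ = mk≋ ((λ i → ⊕-identityʳ (f i)) , (λ _ → refl))

  ·-inverseʳ : ∀ x → x · inv x ≋ one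
  ·-inverseʳ ⟨ f , π ⟩ =
    mk≋ ((λ i → trans (cong (λ j → f i ⊕ (⊖ f j)) (inverseʳ π)) (⊕-inverseʳ (f i))) , (λ _ → inverseʳ π))

  ·-inverseˡ : ∀ x → inv x · x ≋ one
  ·-inverseˡ ⟨ f , π ⟩ = mk≋ ((λ i → ⊕-inverseˡ (f (π ⟨$⟩ʳ i))) , (λ _ → inverseˡ π))

  ^-cong : ∀ {x y} k → x ≋ y → x ^ k ≋ y ^ k
  ^-cong zero    _   = ≋-refl
  ^-cong (suc k) x≋y = ·-cong x≋y (^-cong k x≋y)

  ^-+ : ∀ x a b → x ^ (a ℕ.+ b) ≋ (x ^ a) · (x ^ b)
  ^-+ x zero    b = ≋-sym (·-identityˡ _)
  ^-+ x (suc a) b = ≋-trans (·-congʳ x (^-+ x a b)) (≋-sym (·-assoc x (x ^ a) (x ^ b)))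

  ^-* : ∀ x a b → (x ^ a) ^ b ≋ x ^ (a ℕ.* b)
  ^-* x a zero    rewrite NP.*-zeroʳ a  = ≋-refl
  ^-* x a (suc b) rewrite NP.*-suc a b =
    ≋-trans (·-congʳ (x ^ a) (^-* x a b)) (≋-sym (^-+ x a (a ℕ.* b)))

  conj-cong : ∀ h {x y} → x ≋ y → conj h x ≋ conj h y
  conj-cong h x≋y = ·-congˡ (inv h) (·-congʳ h x≋y)

  conj-one : ∀ h → conj h one ≋ one
  conj-one h = ≋-trans (·-congˡ (inv h) (·-identityʳ h)) (·-inverseʳ h)

  conj-· : ∀ h x y → conj h (x · y) ≋ conj h x · conj h y
  conj-· h x y = ≋-sym (begin
    ((h · x) · inv h) · ((h · y) · inv h) ≈⟨ ·-assoc (h · x) (inv h) ((h · y) · inv h) ⟩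
    (h · x) · (inv h · ((h · y) · inv h)) ≈⟨ ·-congʳ (h · x) (·-assoc (inv h) (h · y) (inv h)) ⟨
    (h · x) · ((inv h · (h · y)) · inv h) ≈⟨ ·-congʳ (h · x) (·-congˡ (inv h) (·-assoc (inv h) h y)) ⟨
    (h · x) · (((inv h · h) · y) · inv h) ≈⟨ ·-congʳ (h · x) (·-congˡ (inv h) (·-congˡ y (·-inverseˡ h))) ⟩
    (h · x) · ((one · y) · inv h)         ≈⟨ ·-congʳ (h · x) (·-congˡ (inv h) (·-identityˡ y)) ⟩
    (h · x) · (y · inv h)                 ≈⟨ ·-assoc h x (y · inv h) ⟩
    h · (x · (y · inv h))                 ≈⟨ ·-congʳ h (·-assoc x y (inv h)) ⟨
    h · ((x · y) · inv h)                 ≈⟨ ·-assoc h (x · y) (inv h) ⟨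
    (h · (x · y)) · inv h                 ∎)
    where open SetoidReasoning ≋-setoid

  conj-^ : ∀ h x k → conj h (x ^ k) ≋ conj h x ^ k
  conj-^ h x zero    = conj-one h
  conj-^ h x (suc k) = ≋-trans (conj-· h x (x ^ k)) (·-congʳ (conj h x) (conj-^ h x k))

  SameCyclicSubgroup : W n r → W n r → Set
  SameCyclicSubgroup x g = Σ[ k ∈ ℕ ] Σ[ l ∈ ℕ ] x ≋ g ^ k × g ^ (k ℕ.* l) ≋ g

  sameCyclicSubgroup⇒ConjugateCyclic : ∀ {w g} h → SameCyclicSubgroup (conj h w) g → ConjugateCyclic w g
  sameCyclicSubgroup⇒ConjugateCyclic {w} {g} h (k , l , hwh⁻¹≋gᵏ , gᵏˡ≋g) = h , into , onto
    where
    into : ∀ x → x ∈⟨ w ⟩ → conj h x ∈⟨ g ⟩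
    into x (m , wᵐ≈x) = k ℕ.* m , unwrap (begin
      g ^ (k ℕ.* m)     ≈⟨ ^-* g k m ⟨
      (g ^ k) ^ m       ≈⟨ ^-cong m hwh⁻¹≋gᵏ ⟨
      conj h w ^ m      ≈⟨ conj-^ h w m ⟨
      conj h (w ^ m)    ≈⟨ conj-cong h (mk≋ {w ^ m} {x} wᵐ≈x) ⟩
      conj h x          ∎)
      where open SetoidReasoning ≋-setoid
    onto : ∀ y → y ∈⟨ g ⟩ → Σ[ x ∈ W n r ] (x ∈⟨ w ⟩ × conj h x ≈W y)
    onto y (m , gᵐ≈y) = w ^ (l ℕ.* m) , (l ℕ.* m , unwrap (≋-refl {w ^ (l ℕ.* m)})) , unwrap (begin
      conj h (w ^ (l ℕ.* m)) ≈⟨ conj-cong h (^-* w l m) ⟨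
      conj h ((w ^ l) ^ m)   ≈⟨ conj-^ h (w ^ l) m ⟩
      conj h (w ^ l) ^ m     ≈⟨ ^-cong m (conj-^ h w l) ⟩
      (conj h w ^ l) ^ m     ≈⟨ ^-cong m (^-cong l hwh⁻¹≋gᵏ) ⟩
      ((g ^ k) ^ l) ^ m      ≈⟨ ^-cong m (^-* g k l) ⟩
      (g ^ (k ℕ.* l)) ^ m    ≈⟨ ^-cong m gᵏˡ≋g ⟩
      g ^ m                  ≈⟨ mk≋ {g ^ m} {y} gᵐ≈y ⟩
      y                      ∎)
      where open SetoidReasoning ≋-setoid

  conj≋⇒ConjugateCyclic : ∀ {w g} h → conj h w ≋ g → ConjugateCyclic w g
  conj≋⇒ConjugateCyclic {g = g} h hwh⁻¹≋g =
    sameCyclicSubgroup⇒ConjugateCyclic h (1 , 1 , ≋-trans hwh⁻¹≋g (≋-sym (·-identityʳ g)) , ·-identityʳ g)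

  act-· : ∀ x y (p : X {n} {r}) → act (x · y) p ≡ act x (act y p)
  act-· ⟨ f , π ⟩ ⟨ g , σ ⟩ (a , i) = cong (_, π ⟨$⟩ʳ (σ ⟨$⟩ʳ i)) (begin
    (f j ⊕ g (π ⟨$⟩ˡ j)) ⊕ a ≡⟨ cong (λ k → (f j ⊕ g k) ⊕ a) (inverseˡ π) ⟩
    (f j ⊕ g (σ ⟨$⟩ʳ i)) ⊕ a ≡⟨ ⊕-assoc (f j) (g (σ ⟨$⟩ʳ i)) a ⟩
    f j ⊕ (g (σ ⟨$⟩ʳ i) ⊕ a) ∎)
    where
    open ≡-Reasoning
    j = π ⟨$⟩ʳ (σ ⟨$⟩ʳ i)

  act-one : ∀ (p : X {n} {r}) → act one p ≡ p
  act-one (a , i) = cong (_, i) (⊕-identityˡ a)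

module Blocks {n r : ℕ} {{_ : NonZero n}} where
  open Permutations
  open ℤMod
  open WreathProduct
  open Counting

  FixesBlock : W n r → Fin r → Set
  FixesBlock w i = perm w ⟨$⟩ʳ i ≡ i × fun w i ≡ zeroZ

  fixesBlock? : ∀ w → Decidable (FixesBlock w)
  fixesBlock? w i = (perm w ⟨$⟩ʳ i ≟ i) ×-dec (fun w i ≟ zeroZ)

  fixesPoint⇔fixesBlock : ∀ w a i → act w (a , i) ≡ (a , i) ⇔ FixesBlock w i
  fixesPoint⇔fixesBlock ⟨ f , π ⟩ a i = mk⇔ to from
    where
    to : act ⟨ f , π ⟩ (a , i) ≡ (a , i) → FixesBlock ⟨ f , π ⟩ i
    to fixed = πi≡i , subst (λ j → f j ≡ zeroZ) πi≡i (x⊕a≡a⇒x≡0 (,-injectiveˡ fixed))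
      where πi≡i = ,-injectiveʳ fixed
    from : FixesBlock ⟨ f , π ⟩ i → act ⟨ f , π ⟩ (a , i) ≡ (a , i)
    from (πi≡i , fi≡0) rewrite πi≡i | fi≡0 = cong (_, i) (⊕-identityˡ a)

  movedBlocks : W n r → ℕ
  movedBlocks w = count (¬? ∘ fixesBlock? w)

  movedCount≡n*movedBlocks : ∀ w → movedCount w ≡ n ℕ.* movedBlocks w
  movedCount≡n*movedBlocks w = begin
    movedCount w
      ≡⟨ length-filter-cartesianProduct (λ p → ¬? (act w p ≟X p)) (¬? ∘ fixesBlock? w) moved⇔ (allFin n) (allFin r) ⟩
    length (allFin n) ℕ.* movedBlocks w
      ≡⟨ cong (ℕ._* movedBlocks w) (LP.length-tabulate {n = n} id) ⟩
    n ℕ.* movedBlocks w ∎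
    where
    open ≡-Reasoning
    moved⇔ : ∀ a i → (¬ act w (a , i) ≡ (a , i)) ⇔ (¬ FixesBlock w i)
    moved⇔ a i = mk⇔ (λ ¬fixed fixes → ¬fixed (Equivalence.from (fixesPoint⇔fixesBlock w a i) fixes))
                     (λ ¬fixes fixed → ¬fixes (Equivalence.to (fixesPoint⇔fixesBlock w a i) fixed))

  act-^-fixed : ∀ w (p : X {n} {r}) k → act w p ≡ p → act (w ^ k) p ≡ p
  act-^-fixed w p zero    _       = act-one p
  act-^-fixed w p (suc k) w-fixes = begin
    act (w · (w ^ k)) p ≡⟨ act-· w (w ^ k) p ⟩
    act w (act (w ^ k) p) ≡⟨ cong (act w) (act-^-fixed w p k w-fixes) ⟩
    act w p             ≡⟨ w-fixes ⟩
    p                   ∎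
    where open ≡-Reasoning

  hasCycleType⇒act-^≡id : ∀ {w a b} → HasCycleType w a b → ∀ p → act (w ^ a) p ≡ p
  hasCycleType⇒act-^≡id {w} {a} (_ , cycles , _) p with act w p ≟X p
  ... | yes fixed = act-^-fixed w p a fixed
  ... | no moved  = proj₁ (proj₂ (cycles p moved))

  hasCycleType⇒movedBlocks : ∀ {w a b} k → HasCycleType w a b → a ℕ.* b ≡ n ℕ.* k → movedBlocks w ≡ k
  hasCycleType⇒movedBlocks {w} k (_ , _ , count≡) ab≡nk =
    NP.*-cancelˡ-≡ (movedBlocks w) k n (trans (sym (movedCount≡n*movedBlocks w)) (trans count≡ ab≡nk))

  movedBlock⇒cycleLength : ∀ {w a b} → HasCycleType w a b → ∀ i → ¬ FixesBlock w i → CycleLength w (zeroZ , i) a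
  movedBlock⇒cycleLength {w} (_ , cycles , _) i moved = cycles (zeroZ , i) (moved ∘ Equivalence.to (fixesPoint⇔fixesBlock w zeroZ i))

  act-^2 : ∀ w (p : X {n} {r}) → act (w ^ 2) p ≡ act w (act w p)
  act-^2 w p = begin
    act (w · (w · one)) p     ≡⟨ act-· w (w · one) p ⟩
    act w (act (w · one) p)   ≡⟨ cong (act w) (act-· w one p) ⟩
    act w (act w (act one p)) ≡⟨ cong (act w ∘ act w) (act-one p) ⟩
    act w (act w p)           ∎
    where open ≡-Reasoning

  -- On each 2-cycle {i, π i} with π i < i, the shift carries f (π i) to the larger point i;
  -- conjugating by it cancels f on the whole 2-cycle, since f i ⊕ f (π i) ≡ 0.
  module Normalise (w : W n r) (π-involutive : ∀ i → perm w ⟨$⟩ʳ (perm w ⟨$⟩ʳ i) ≡ i)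
                   (f-cancels : ∀ i → perm w ⟨$⟩ʳ i ≢ i → fun w i ⊕ fun w (perm w ⟨$⟩ʳ i) ≡ zeroZ) where
    private
      f = fun w
      π = perm w ⟨$⟩ʳ_

      π⁻¹≡π : ∀ i → perm w ⟨$⟩ˡ i ≡ π i
      π⁻¹≡π i = trans (cong (perm w ⟨$⟩ˡ_) (sym (π-involutive i))) (inverseˡ (perm w))

    shift : Fin r → Fin n
    shift i with π i <? i
    ... | yes _ = f (π i)
    ... | no  _ = zeroZ

    shift-< : ∀ i → π i < i → shift i ≡ f (π i)
    shift-< i πi<i with π i <? i
    ... | yes _    = refl
    ... | no πi≮i = contradiction πi<i πi≮i

    shift-≮ : ∀ i → ¬ π i < i → shift i ≡ zeroZ
    shift-≮ i πi≮i with π i <? i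
    ... | yes πi<i = contradiction πi<i πi≮i
    ... | no _     = refl

    shiftedFun : Fin r → Fin n
    shiftedFun i = (shift i ⊕ f i) ⊕ (⊖ shift (perm w ⟨$⟩ˡ i))

    shiftedFun-fixed : ∀ i → π i ≡ i → shiftedFun i ≡ f i
    shiftedFun-fixed i πi≡i = begin
      (shift i ⊕ f i) ⊕ (⊖ shift (perm w ⟨$⟩ˡ i))
        ≡⟨ cong (λ j → (shift i ⊕ f i) ⊕ (⊖ shift j)) (trans (π⁻¹≡π i) πi≡i) ⟩
      (shift i ⊕ f i) ⊕ (⊖ shift i)
        ≡⟨ cong (λ k → (k ⊕ f i) ⊕ (⊖ k)) (shift-≮ i (λ πi<i → FP.<-irrefl πi≡i πi<i)) ⟩
      (zeroZ ⊕ f i) ⊕ (⊖ zeroZ)                   ≡⟨ cong₂ _⊕_ (⊕-identityˡ (f i)) ⊖-zero ⟩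
      f i ⊕ zeroZ                                 ≡⟨ ⊕-identityʳ (f i) ⟩
      f i                                         ∎
      where open ≡-Reasoning

    shiftedFun-moved : ∀ i → π i ≢ i → shiftedFun i ≡ zeroZ
    shiftedFun-moved i πi≢i with π i <? i
    ... | yes πi<i = begin
      (f (π i) ⊕ f i) ⊕ (⊖ shift (perm w ⟨$⟩ˡ i)) ≡⟨ cong (λ j → (f (π i) ⊕ f i) ⊕ (⊖ shift j)) (π⁻¹≡π i) ⟩
      (f (π i) ⊕ f i) ⊕ (⊖ shift (π i))         ≡⟨ cong (λ k → (f (π i) ⊕ f i) ⊕ (⊖ k)) (shift-≮ (π i) ππi≮πi) ⟩
      (f (π i) ⊕ f i) ⊕ (⊖ zeroZ)               ≡⟨ cong₂ _⊕_ (⊕-comm (f (π i)) (f i)) ⊖-zero ⟩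
      (f i ⊕ f (π i)) ⊕ zeroZ                   ≡⟨ ⊕-identityʳ _ ⟩
      f i ⊕ f (π i)                             ≡⟨ f-cancels i πi≢i ⟩
      zeroZ                                     ∎
      where
      open ≡-Reasoning
      ππi≮πi : ¬ π (π i) < π i
      ππi≮πi ππi<πi = FP.<-asym πi<i (subst (_< π i) (π-involutive i) ππi<πi)
    ... | no πi≮i = begin
      (zeroZ ⊕ f i) ⊕ (⊖ shift (perm w ⟨$⟩ˡ i)) ≡⟨ cong (λ j → (zeroZ ⊕ f i) ⊕ (⊖ shift j)) (π⁻¹≡π i) ⟩
      (zeroZ ⊕ f i) ⊕ (⊖ shift (π i))
        ≡⟨ cong (λ k → (zeroZ ⊕ f i) ⊕ (⊖ k)) (trans (shift-< (π i) ππi<πi) (cong f (π-involutive i))) ⟩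
      (zeroZ ⊕ f i) ⊕ (⊖ f i)                 ≡⟨ cong (_⊕ (⊖ f i)) (⊕-identityˡ (f i)) ⟩
      f i ⊕ (⊖ f i)                           ≡⟨ ⊕-inverseʳ (f i) ⟩
      zeroZ                                   ∎
      where
      open ≡-Reasoning
      ππi<πi : π (π i) < π i
      ππi<πi = subst (_< π i) (sym (π-involutive i)) (FP.≤∧≢⇒< (NP.≮⇒≥ πi≮i) (πi≢i ∘ sym))

    conjugator : Permutation′ r → W n r
    conjugator σ = ⟨ shift ∘ (σ ⟨$⟩ˡ_) , σ ⟩

    conj-conjugator : ∀ (σ : Permutation′ r) g →
      (∀ i → σ ⟨$⟩ʳ π i ≡ perm g ⟨$⟩ʳ (σ ⟨$⟩ʳ i)) →
      (∀ i → π i ≡ i → fun g (σ ⟨$⟩ʳ i) ≡ f i) →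
      (∀ i → π i ≢ i → fun g (σ ⟨$⟩ʳ i) ≡ zeroZ) →
      conj (conjugator σ) w ≋ g
    conj-conjugator σ g σπ≡gσ g-fixed g-moved = mk≋ (fun≡ , perm≡)
      where
      shiftedFun≡g : ∀ i → shiftedFun i ≡ fun g (σ ⟨$⟩ʳ i)
      shiftedFun≡g i with π i ≟ i
      ... | yes πi≡i = trans (shiftedFun-fixed i πi≡i) (sym (g-fixed i πi≡i))
      ... | no πi≢i  = trans (shiftedFun-moved i πi≢i) (sym (g-moved i πi≢i))

      fun≡ : ∀ i → fun (conj (conjugator σ) w) i ≡ fun g i
      fun≡ i = trans (cong (λ j → (shift (σ ⟨$⟩ˡ i) ⊕ f (σ ⟨$⟩ˡ i)) ⊕ (⊖ shift j)) (inverseˡ σ))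
                     (trans (shiftedFun≡g (σ ⟨$⟩ˡ i)) (cong (fun g) (inverseʳ σ)))

      perm≡ : ∀ i → perm (conj (conjugator σ) w) ⟨$⟩ʳ i ≡ perm g ⟨$⟩ʳ i
      perm≡ i = trans (σπ≡gσ (σ ⟨$⟩ˡ i)) (cong (perm g ⟨$⟩ʳ_) (inverseʳ σ))

  module OrderTwo (w : W n r) (w²-trivial : ∀ p → act (w ^ 2) p ≡ p) where
    private
      f = fun w
      π = perm w ⟨$⟩ʳ_

      w∘w-fixes : ∀ i → ((f (π (π i)) ⊕ (f (π i) ⊕ zeroZ)) , π (π i)) ≡ (zeroZ , i)
      w∘w-fixes i = trans (sym (act-^2 w (zeroZ , i))) (w²-trivial (zeroZ , i))

    π-involutive : ∀ i → π (π i) ≡ i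
    π-involutive i = ,-injectiveʳ (w∘w-fixes i)

    f-cancels : ∀ i → f i ⊕ f (π i) ≡ zeroZ
    f-cancels i = begin
      f i ⊕ f (π i)                ≡⟨ cong (λ j → f j ⊕ f (π i)) (π-involutive i) ⟨
      f (π (π i)) ⊕ f (π i)        ≡⟨ cong (f (π (π i)) ⊕_) (⊕-identityʳ (f (π i))) ⟨
      f (π (π i)) ⊕ (f (π i) ⊕ zeroZ) ≡⟨ ,-injectiveˡ (w∘w-fixes i) ⟩
      zeroZ                        ∎
      where open ≡-Reasoning

    fixedBlock-hasOrder-2 : ∀ i → π i ≡ i → ¬ FixesBlock w i → HasOrder (f i) 2
    fixedBlock-hasOrder-2 i πi≡i moved =
      v⊕v≡0⇒hasOrder-2 (subst (λ j → f i ⊕ f j ≡ zeroZ) πi≡i (f-cancels i)) (λ fi≡0 → moved (πi≡i , fi≡0))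

    conjugateCyclic : ∀ (σ : Permutation′ r) g →
      (∀ i → σ ⟨$⟩ʳ π i ≡ perm g ⟨$⟩ʳ (σ ⟨$⟩ʳ i)) →
      (∀ i → π i ≡ i → fun g (σ ⟨$⟩ʳ i) ≡ f i) →
      (∀ i → π i ≢ i → fun g (σ ⟨$⟩ʳ i) ≡ zeroZ) →
      ConjugateCyclic w g
    conjugateCyclic σ g σπ≡gσ g-fixed g-moved =
      conj≋⇒ConjugateCyclic (Norm.conjugator σ) (Norm.conj-conjugator σ g σπ≡gσ g-fixed g-moved)
      where module Norm = Normalise w π-involutive (λ i _ → f-cancels i)

  act-^-stableBlock : ∀ (w : W n r) i → perm w ⟨$⟩ʳ i ≡ i → ∀ k a → act (w ^ k) (a , i) ≡ ((k ×ℤ fun w i) ⊕ a , i)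
  act-^-stableBlock w i πi≡i zero    a = refl
  act-^-stableBlock w i πi≡i (suc k) a = begin
    act (w · (w ^ k)) (a , i)                          ≡⟨ act-· w (w ^ k) (a , i) ⟩
    act w (act (w ^ k) (a , i))                        ≡⟨ cong (act w) (act-^-stableBlock w i πi≡i k a) ⟩
    (fun w (π i) ⊕ ((k ×ℤ fun w i) ⊕ a) , π i)          ≡⟨ cong (λ j → (fun w j ⊕ ((k ×ℤ fun w i) ⊕ a) , j)) πi≡i ⟩
    (fun w i ⊕ ((k ×ℤ fun w i) ⊕ a) , i)                ≡⟨ cong (_, i) (⊕-assoc (fun w i) (k ×ℤ fun w i) a) ⟨
    ((fun w i ⊕ (k ×ℤ fun w i)) ⊕ a , i)                ∎
    where
    open ≡-Reasoning
    π = perm w ⟨$⟩ʳ_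

  blockElement : Fin r → Fin n → W n r
  blockElement j v = ⟨ (λ i → if does (i ≟ j) then v else zeroZ) , Perm.id ⟩

  blockElement-at : ∀ j v → fun (blockElement j v) j ≡ v
  blockElement-at j v rewrite dec-true (j ≟ j) refl = refl

  blockElement-off : ∀ j v i → i ≢ j → fun (blockElement j v) i ≡ zeroZ
  blockElement-off j v i i≢j rewrite dec-false (i ≟ j) i≢j = refl

  module SingleBlock (w : W n r) (one-moved : movedBlocks w ≡ 1) where
    private
      π = perm w ⟨$⟩ʳ_
      unique = count≡1⇒unique (¬? ∘ fixesBlock? w) one-moved

    block : Fin r
    block = proj₁ unique

    block-moved : ¬ FixesBlock w block
    block-moved = proj₁ (proj₂ unique)

    fixes-others : ∀ i → i ≢ block → FixesBlock w i
    fixes-others i i≢block = decidable-stable (fixesBlock? w i) (λ ¬fixes → i≢block (proj₂ (proj₂ unique) i ¬fixes))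

    π-id : ∀ i → π i ≡ i
    π-id i with i ≟ block
    ... | no i≢block  = proj₁ (fixes-others i i≢block)
    ... | yes refl with π block ≟ block
    ...   | yes πb≡b  = πb≡b
    ...   | no πb≢b   = contradiction (⟨$⟩ʳ-injective (perm w) (proj₁ (fixes-others (π block) πb≢b))) πb≢b

    block-hasOrder : ∀ {a b} → HasCycleType w a b → HasOrder (fun w block) a
    block-hasOrder {a} cycleType = a×v≡0 , λ m 1≤m m<a mv≡0 → minimal m 1≤m m<a (fixed-by m mv≡0)
      where
      v = fun w block
      wᵃ-fixes = proj₁ (proj₂ (movedBlock⇒cycleLength cycleType block block-moved))
      minimal  = proj₂ (proj₂ (movedBlock⇒cycleLength cycleType block block-moved))
      orbit : ∀ k → act (w ^ k) (zeroZ , block) ≡ ((k ×ℤ v) ⊕ zeroZ , block)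
      orbit k = act-^-stableBlock w block (π-id block) k zeroZ
      a×v≡0 : a ×ℤ v ≡ zeroZ
      a×v≡0 = trans (sym (⊕-identityʳ (a ×ℤ v))) (,-injectiveˡ (trans (sym (orbit a)) wᵃ-fixes))
      fixed-by : ∀ m → m ×ℤ v ≡ zeroZ → act (w ^ m) (zeroZ , block) ≡ (zeroZ , block)
      fixed-by m mv≡0 = trans (orbit m) (cong (_, block) (trans (⊕-identityʳ (m ×ℤ v)) mv≡0))

    conj-blockElement : ∀ j → Σ[ h ∈ W n r ] conj h w ≋ blockElement j (fun w block)
    conj-blockElement j = Norm.conjugator σ , Norm.conj-conjugator σ g σπ≡σ g-fixed g-moved
      where
      module Norm = Normalise w (λ i → trans (π-id (π i)) (π-id i)) (λ i πi≢i → contradiction (π-id i) πi≢i)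
      σ = transpose block j
      g = blockElement j (fun w block)
      σπ≡σ : ∀ i → σ ⟨$⟩ʳ π i ≡ σ ⟨$⟩ʳ i
      σπ≡σ i = cong (σ ⟨$⟩ʳ_) (π-id i)
      g-fixed : ∀ i → π i ≡ i → fun g (σ ⟨$⟩ʳ i) ≡ fun w i
      g-fixed i _ = g-at i (i ≟ block)
        where
        g-at : ∀ i → Dec (i ≡ block) → fun g (σ ⟨$⟩ʳ i) ≡ fun w i
        g-at i (yes i≡block) = begin
          fun g (σ ⟨$⟩ʳ i)     ≡⟨ cong (λ k → fun g (σ ⟨$⟩ʳ k)) i≡block ⟩
          fun g (σ ⟨$⟩ʳ block) ≡⟨ cong (fun g) (transpose-matchˡ block j) ⟩
          fun g j             ≡⟨ blockElement-at j (fun w block) ⟩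
          fun w block         ≡⟨ cong (fun w) i≡block ⟨
          fun w i             ∎
          where open ≡-Reasoning
        g-at i (no i≢block) = trans (blockElement-off j (fun w block) (σ ⟨$⟩ʳ i) σi≢j) (sym (proj₂ (fixes-others i i≢block)))
          where
          σi≢j : σ ⟨$⟩ʳ i ≢ j
          σi≢j σi≡j = i≢block (⟨$⟩ʳ-injective σ (trans σi≡j (sym (transpose-matchˡ block j))))
      g-moved : ∀ i → π i ≢ i → fun g (σ ⟨$⟩ʳ i) ≡ zeroZ
      g-moved i πi≢i = contradiction (π-id i) πi≢i

    conjugateCyclic : ∀ j g → SameCyclicSubgroup (blockElement j (fun w block)) g → ConjugateCyclic w g
    conjugateCyclic j g (k , l , w′≋gᵏ , gᵏˡ≋g) with conj-blockElement j
    ... | h , hwh⁻¹≋w′ = sameCyclicSubgroup⇒ConjugateCyclic h (k , l , ≋-trans hwh⁻¹≋w′ w′≋gᵏ , gᵏˡ≋g)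

module InvolutionNormalForm where
  open Permutations

  pairLo pairHi : ℕ → Fin 9
  pairLo c = pt (8 ℕ.∸ 2 ℕ.* c)
  pairHi c = pt (9 ℕ.∸ 2 ℕ.* c)

  -- standardInvolution c is the permutation part of γ_c, the product of τ_{8-2i, 9-2i} for i < c;
  -- it moves exactly the points of Top c, the top 2c points.
  standardInvolution : ℕ → Fin 9 → Fin 9
  standardInvolution zero    y = y
  standardInvolution (suc c) y = transpose (pairLo c) (pairHi c) ⟨$⟩ʳ standardInvolution c y

  Top : ℕ → Fin 9 → Set
  Top c y = 9 ℕ.∸ 2 ℕ.* c ℕ.≤ toℕ y

  top? : ∀ c y → Dec (Top c y)
  top? c y = 9 ℕ.∸ 2 ℕ.* c ℕ.≤? toℕ y

  ¬top-zero : ∀ y → ¬ Top 0 y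
  ¬top-zero y top = NP.<⇒≱ (FP.toℕ<n y) top

  top-suc : ∀ {c} → c ℕ.< 4 → ∀ y → Top (suc c) y → Top c y ⊎ y ≡ pairLo c ⊎ y ≡ pairHi c
  top-suc = from-yes (NP.allUpTo? (λ c → FP.all? λ y → top? (suc c) y →-dec (top? c y ⊎-dec (y ≟ pairLo c ⊎-dec y ≟ pairHi c))) 4)

  pair-¬top : ∀ {c} → c ℕ.< 4 → ¬ Top c (pairLo c) × ¬ Top c (pairHi c) × pairLo c ≢ pairHi c
  pair-¬top = from-yes (NP.allUpTo? (λ c → ¬? (top? c (pairLo c)) ×-dec ¬? (top? c (pairHi c)) ×-dec ¬? (pairLo c ≟ pairHi c)) 4)

  ¬top⇒≤pairHi : ∀ {c} → c ℕ.< 4 → ∀ y → ¬ Top c y → toℕ y ℕ.≤ toℕ (pairHi c)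
  ¬top⇒≤pairHi = from-yes (NP.allUpTo? (λ c → FP.all? λ y → ¬? (top? c y) →-dec (toℕ y ℕ.≤? toℕ (pairHi c))) 4)

  standardInvolution-pair : ∀ {c} → c ℕ.< 4 →
    standardInvolution (suc c) (pairLo c) ≡ pairHi c × standardInvolution (suc c) (pairHi c) ≡ pairLo c
  standardInvolution-pair = from-yes (NP.allUpTo? (λ c →
    (standardInvolution (suc c) (pairLo c) ≟ pairHi c) ×-dec (standardInvolution (suc c) (pairHi c) ≟ pairLo c)) 4)

  standardInvolution-suc-top : ∀ {c} → c ℕ.< 4 → ∀ y → Top c y → standardInvolution (suc c) y ≡ standardInvolution c y
  standardInvolution-suc-top = from-yes (NP.allUpTo? (λ c → FP.all? λ y →
    top? c y →-dec (standardInvolution (suc c) y ≟ standardInvolution c y)) 4)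

  standardInvolution-top : ∀ {c} → c ℕ.< 5 → ∀ y → Top c y → Top c (standardInvolution c y)
  standardInvolution-top = from-yes (NP.allUpTo? (λ c → FP.all? λ y → top? c y →-dec top? c (standardInvolution c y)) 5)

  standardInvolution-¬top : ∀ {c} → c ℕ.< 5 → ∀ y → ¬ Top c y → standardInvolution c y ≡ y
  standardInvolution-¬top = from-yes (NP.allUpTo? (λ c → FP.all? λ y → ¬? (top? c y) →-dec (standardInvolution c y ≟ y)) 5)

  ¬top-four : ∀ y → ¬ Top 4 y → y ≡ fz
  ¬top-four = from-yes (FP.all? λ y → ¬? (top? 4 y) →-dec (y ≟ fz))

  NormalForm : (Fin 9 → Fin 9) → Set
  NormalForm π = Σ[ j ∈ Fin 5 ] Σ[ σ ∈ Permutation′ 9 ] (∀ i → σ ⟨$⟩ʳ π i ≡ standardInvolution (toℕ j) (σ ⟨$⟩ʳ i))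

  AgreesOnTop : ℕ → (Fin 9 → Fin 9) → Set
  AgreesOnTop c π = ∀ y → Top c y → π y ≡ standardInvolution c y

  Involutive : (Fin 9 → Fin 9) → Set
  Involutive π = ∀ i → π (π i) ≡ i

  conjugateBy : Permutation′ 9 → (Fin 9 → Fin 9) → Fin 9 → Fin 9
  conjugateBy τ π y = τ ⟨$⟩ʳ π (τ ⟨$⟩ʳ y)

  module _ (τ : Permutation′ 9) (τ-involutive : Involutive (τ ⟨$⟩ʳ_)) (π : Fin 9 → Fin 9) where

    conjugateBy-involutive : Involutive π → Involutive (conjugateBy τ π)
    conjugateBy-involutive π-involutive i = begin
      τ ⟨$⟩ʳ π (τ ⟨$⟩ʳ (τ ⟨$⟩ʳ π (τ ⟨$⟩ʳ i))) ≡⟨ cong (λ k → τ ⟨$⟩ʳ π k) (τ-involutive _) ⟩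
      τ ⟨$⟩ʳ π (π (τ ⟨$⟩ʳ i))               ≡⟨ cong (τ ⟨$⟩ʳ_) (π-involutive _) ⟩
      τ ⟨$⟩ʳ (τ ⟨$⟩ʳ i)                     ≡⟨ τ-involutive i ⟩
      i                                    ∎
      where open ≡-Reasoning

    normalForm-conjugateBy : NormalForm (conjugateBy τ π) → NormalForm π
    normalForm-conjugateBy (j , σ , σπ′≡std) = j , τ ∘ₚ σ , λ i →
      trans (cong (λ k → σ ⟨$⟩ʳ (τ ⟨$⟩ʳ π k)) (sym (τ-involutive i))) (σπ′≡std (τ ⟨$⟩ʳ i))

  -- One greedy step: a 2-cycle (q m) of π below the top is moved onto the next standard pair
  -- (pairLo c, pairHi c), the larger point m going to pairHi c.
  module Step {c} (c<4 : c ℕ.< 4) (π : Fin 9 → Fin 9) (π-involutive : Involutive π) (agrees : AgreesOnTop c π)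
              (m : Fin 9) (m-low : ¬ Top c m) (q-low : ¬ Top c (π m)) (q<m : π m < m) where
    private
      q = π m
      a = pairLo c
      b = pairHi c
      a-low = proj₁ (pair-¬top c<4)
      b-low = proj₁ (proj₂ (pair-¬top c<4))
      a≢b   = proj₂ (proj₂ (pair-¬top c<4))
      τ₁ = transpose b m
      τ₂ = transpose a q
      π₁ = conjugateBy τ₁ π

      top≢low : ∀ {y z} → Top c y → ¬ Top c z → y ≢ z
      top≢low top-y low-z y≡z = low-z (subst (Top c) y≡z top-y)

      q≢m : q ≢ m
      q≢m q≡m = FP.<-irrefl q≡m q<m

      q≢b : q ≢ b
      q≢b q≡b = NP.<⇒≱ q<m (subst (λ k → toℕ m ℕ.≤ toℕ k) (sym q≡b) (¬top⇒≤pairHi c<4 m m-low))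

      τ₁-top : ∀ y → Top c y → τ₁ ⟨$⟩ʳ y ≡ y
      τ₁-top y top = transpose-mismatch b m y (top≢low top b-low) (top≢low top m-low)

      τ₂-top : ∀ y → Top c y → τ₂ ⟨$⟩ʳ y ≡ y
      τ₂-top y top = transpose-mismatch a q y (top≢low top a-low) (top≢low top q-low)

    π₂ : Fin 9 → Fin 9
    π₂ = conjugateBy τ₂ π₁

    π₂-involutive : Involutive π₂
    π₂-involutive = conjugateBy-involutive τ₂ (transpose-involutive a q) π₁
                      (conjugateBy-involutive τ₁ (transpose-involutive b m) π π-involutive)

    π₂-pairHi : π₂ b ≡ a
    π₂-pairHi = begin
      τ₂ ⟨$⟩ʳ π₁ (τ₂ ⟨$⟩ʳ b) ≡⟨ cong (λ k → τ₂ ⟨$⟩ʳ π₁ k) (transpose-mismatch a q b (a≢b ∘ sym) (q≢b ∘ sym)) ⟩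
      τ₂ ⟨$⟩ʳ π₁ b           ≡⟨ cong (λ k → τ₂ ⟨$⟩ʳ (τ₁ ⟨$⟩ʳ π k)) (transpose-matchˡ b m) ⟩
      τ₂ ⟨$⟩ʳ (τ₁ ⟨$⟩ʳ q)     ≡⟨ cong (τ₂ ⟨$⟩ʳ_) (transpose-mismatch b m q q≢b q≢m) ⟩
      τ₂ ⟨$⟩ʳ q              ≡⟨ transpose-matchʳ a q ⟩
      a                     ∎
      where open ≡-Reasoning

    π₂-agrees : AgreesOnTop (suc c) π₂
    π₂-agrees y top with top-suc c<4 y top
    ... | inj₁ top-y = begin
      τ₂ ⟨$⟩ʳ π₁ (τ₂ ⟨$⟩ʳ y)                  ≡⟨ cong (λ k → τ₂ ⟨$⟩ʳ π₁ k) (τ₂-top y top-y) ⟩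
      τ₂ ⟨$⟩ʳ π₁ y                            ≡⟨ cong (λ k → τ₂ ⟨$⟩ʳ (τ₁ ⟨$⟩ʳ π k)) (τ₁-top y top-y) ⟩
      τ₂ ⟨$⟩ʳ (τ₁ ⟨$⟩ʳ π y)                    ≡⟨ cong (λ k → τ₂ ⟨$⟩ʳ (τ₁ ⟨$⟩ʳ k)) (agrees y top-y) ⟩
      τ₂ ⟨$⟩ʳ (τ₁ ⟨$⟩ʳ standardInvolution c y) ≡⟨ cong (τ₂ ⟨$⟩ʳ_) (τ₁-top _ top-std) ⟩
      τ₂ ⟨$⟩ʳ standardInvolution c y           ≡⟨ τ₂-top _ top-std ⟩
      standardInvolution c y                  ≡⟨ standardInvolution-suc-top c<4 y top-y ⟨
      standardInvolution (suc c) y            ∎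
      where
      open ≡-Reasoning
      top-std = standardInvolution-top (NP.m≤n⇒m≤1+n c<4) y top-y
    ... | inj₂ (inj₁ refl) = begin
      π₂ a         ≡⟨ cong π₂ π₂-pairHi ⟨
      π₂ (π₂ b)    ≡⟨ π₂-involutive b ⟩
      b            ≡⟨ proj₁ (standardInvolution-pair c<4) ⟨
      standardInvolution (suc c) a ∎
      where open ≡-Reasoning
    ... | inj₂ (inj₂ refl) = trans π₂-pairHi (sym (proj₂ (standardInvolution-pair c<4)))

    normalForm-lift : NormalForm π₂ → NormalForm π
    normalForm-lift = normalForm-conjugateBy τ₁ (transpose-involutive b m) π
                    ∘ normalForm-conjugateBy τ₂ (transpose-involutive a q) π₁

  partner-¬top : ∀ {c} → c ℕ.< 5 → ∀ π → Involutive π → AgreesOnTop c π → ∀ x → ¬ Top c x → ¬ Top c (π x)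
  partner-¬top {c} c<5 π π-involutive agrees x x-low πx-top =
    x-low (subst (Top c) (trans (sym (agrees (π x) πx-top)) (π-involutive x)) (standardInvolution-top c<5 (π x) πx-top))

  larger-point : ∀ {c} π → Involutive π → ∀ x → ¬ Top c x → ¬ Top c (π x) → π x ≢ x →
                 Σ[ m ∈ Fin 9 ] ¬ Top c m × ¬ Top c (π m) × π m < m
  larger-point {c} π π-involutive x x-low πx-low πx≢x with FP.<-cmp (π x) x
  ... | tri< πx<x _ _ = x , x-low , πx-low , πx<x
  ... | tri≈ _ πx≡x _ = contradiction πx≡x πx≢x
  ... | tri> _ _ x<πx = π x , πx-low , subst (λ k → ¬ Top c k) (sym (π-involutive x)) x-low
                        , subst (_< π x) (sym (π-involutive x)) x<πx

  normalForm-agreeing : ∀ {c} → c ℕ.< 5 → ∀ π → AgreesOnTop c π → (∀ y → ¬ Top c y → π y ≡ y) → NormalForm π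
  normalForm-agreeing {c} c<5 π agrees fixes-low = fromℕ< c<5 , Perm.id , λ i →
    trans (π≡standard i) (cong (λ k → standardInvolution k i) (sym (FP.toℕ-fromℕ< c<5)))
    where
    π≡standard : ∀ i → π i ≡ standardInvolution c i
    π≡standard i with top? c i
    ... | yes top = agrees i top
    ... | no low  = trans (fixes-low i low) (sym (standardInvolution-¬top c<5 i low))

  private
    ≤-of-+≡ : ∀ {d c k} → d ℕ.+ c ≡ k → c ℕ.≤ k
    ≤-of-+≡ {d} {c} refl = NP.m≤n+m c d

  -- The greedy induction: d more standard pairs are still free.  Once π fixes every point below
  -- the top, it agrees with standardInvolution c everywhere.
  normalForm-from : ∀ d c → d ℕ.+ c ≡ 4 → ∀ π → Involutive π → AgreesOnTop c π → NormalForm π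
  normalForm-from d c d+c≡4 π π-involutive agrees with FP.any? (λ y → ¬? (top? c y) ×-dec ¬? (π y ≟ y))
  ... | no no-low-moved = normalForm-agreeing {c} (ℕ.s≤s (≤-of-+≡ d+c≡4)) π agrees
      (λ y y-low → decidable-stable (π y ≟ y) (λ πy≢y → no-low-moved (y , y-low , πy≢y)))
  ... | yes (x , x-low , πx≢x) = continue d d+c≡4
    where
    πx-low = partner-¬top {c} (ℕ.s≤s (≤-of-+≡ d+c≡4)) π π-involutive agrees x x-low
    continue : ∀ d → d ℕ.+ c ≡ 4 → NormalForm π
    continue zero    refl      = contradiction (trans (¬top-four (π x) πx-low) (sym (¬top-four x x-low))) πx≢x
    continue (suc d) 1+d+c≡4 with larger-point {c} π π-involutive x x-low πx-low πx≢x
    ... | m , m-low , πm-low , πm<m = S.normalForm-lift (normalForm-from d (suc c) d+1+c≡4 S.π₂ S.π₂-involutive S.π₂-agrees)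
      where
      d+1+c≡4 = trans (NP.+-suc d c) 1+d+c≡4
      module S = Step {c} (≤-of-+≡ d+1+c≡4) π π-involutive agrees m m-low πm-low πm<m

  normalForm : ∀ π → Involutive π → NormalForm π
  normalForm π π-involutive = normalForm-from 4 0 refl π π-involutive (λ y top → contradiction top (¬top-zero y))

module WreathProductOfOrder6On9 where
  open ℤMod
  open WreathProduct
  open Counting
  open Blocks
  open Permutations
  open InvolutionNormalForm using (standardInvolution; NormalForm; normalForm)

  hasOrder-2 : ∀ (v : Fin 6) → HasOrder v 2 → v ≡ # 3
  hasOrder-2 fz                          order = contradiction refl (hasOrder⇒×≢0 1 order)
  hasOrder-2 (fs fz)                     (() , _)
  hasOrder-2 (fs (fs fz))                (() , _)
  hasOrder-2 (fs (fs (fs fz)))           _     = refl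
  hasOrder-2 (fs (fs (fs (fs fz))))      (() , _)
  hasOrder-2 (fs (fs (fs (fs (fs fz))))) (() , _)

  hasOrder-3 : ∀ (v : Fin 6) → HasOrder v 3 → v ≡ # 2 ⊎ v ≡ # 4
  hasOrder-3 fz                          order = contradiction refl (hasOrder⇒×≢0 1 order)
  hasOrder-3 (fs fz)                     (() , _)
  hasOrder-3 (fs (fs fz))                _     = inj₁ refl
  hasOrder-3 (fs (fs (fs fz)))           (() , _)
  hasOrder-3 (fs (fs (fs (fs fz))))      _     = inj₂ refl
  hasOrder-3 (fs (fs (fs (fs (fs fz))))) (() , _)

  hasOrder-6 : ∀ (v : Fin 6) → HasOrder v 6 → v ≡ # 1 ⊎ v ≡ # 5
  hasOrder-6 fz                          order = contradiction refl (hasOrder⇒×≢0 1 order)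
  hasOrder-6 (fs fz)                     _     = inj₁ refl
  hasOrder-6 (fs (fs fz))                order = contradiction refl (hasOrder⇒×≢0 3 order)
  hasOrder-6 (fs (fs (fs fz)))           order = contradiction refl (hasOrder⇒×≢0 2 order)
  hasOrder-6 (fs (fs (fs (fs fz))))      order = contradiction refl (hasOrder⇒×≢0 3 order)
  hasOrder-6 (fs (fs (fs (fs (fs fz))))) _     = inj₂ refl

  singleBlock-conjugateCyclic : ∀ {w : 𝒲} {a b} (g : 𝒲) → HasCycleType w a b → a ℕ.* b ≡ 6 →
    (∀ v → HasOrder v a → SameCyclicSubgroup (blockElement fz v) g) → ConjugateCyclic w g
  singleBlock-conjugateCyclic {w} g cycleType ab≡6 generators =
    conjugateCyclic fz g (generators (fun w block) (block-hasOrder cycleType))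
    where open SingleBlock w (hasCycleType⇒movedBlocks 1 cycleType ab≡6)

  c-generators : ∀ v → HasOrder v 2 → SameCyclicSubgroup (blockElement fz v) c
  c-generators v order rewrite hasOrder-2 v order = 1 , 1 , from-yes (blockElement fz (# 3) ≋? (c ^ 1)) , from-yes ((c ^ 1) ≋? c)

  d-generators : ∀ v → HasOrder v 3 → SameCyclicSubgroup (blockElement fz v) d
  d-generators v order with hasOrder-3 v order
  ... | inj₁ refl = 1 , 1 , from-yes (blockElement fz (# 2) ≋? (d ^ 1)) , from-yes ((d ^ 1) ≋? d)
  ... | inj₂ refl = 2 , 2 , from-yes (blockElement fz (# 4) ≋? (d ^ 2)) , from-yes ((d ^ 4) ≋? d)

  e-generators : ∀ v → HasOrder v 6 → SameCyclicSubgroup (blockElement fz v) e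
  e-generators v order with hasOrder-6 v order
  ... | inj₁ refl = 1 , 1 , from-yes (blockElement fz (# 1) ≋? (e ^ 1)) , from-yes ((e ^ 1) ≋? e)
  ... | inj₂ refl = 5 , 5 , from-yes (blockElement fz (# 5) ≋? (e ^ 5)) , from-yes ((e ^ 25) ≋? e)

  b₀-perm : ∀ y → perm b₀ ⟨$⟩ʳ y ≡ y
  b₀-perm = from-yes (FP.all? λ y → perm b₀ ⟨$⟩ʳ y ≟ y)

  b₀-fun : fun b₀ fz ≡ # 3 × fun b₀ (fs fz) ≡ # 3 × (∀ y → y ≢ fz → y ≢ fs fz → fun b₀ y ≡ zeroZ)
  b₀-fun = from-yes ((fun b₀ fz ≟ # 3) ×-dec (fun b₀ (fs fz) ≟ # 3) ×-dec
                     (FP.all? λ y → ¬? (y ≟ fz) →-dec ¬? (y ≟ fs fz) →-dec (fun b₀ y ≟ zeroZ)))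

  b₁-perm : ∀ y → perm b₁ ⟨$⟩ʳ y ≡ transpose fz (fs fz) ⟨$⟩ʳ y
  b₁-perm = from-yes (FP.all? λ y → perm b₁ ⟨$⟩ʳ y ≟ transpose fz (fs fz) ⟨$⟩ʳ y)

  b₁-fun : ∀ y → fun b₁ y ≡ zeroZ
  b₁-fun = from-yes (FP.all? λ y → fun b₁ y ≟ zeroZ)

  module TwoBlocks (w : 𝒲) (w²-trivial : ∀ p → act (w ^ 2) p ≡ p) {i₀ i₁ : Fin 9} (i₀≢i₁ : i₀ ≢ i₁)
                   (i₀-moved : ¬ FixesBlock w i₀) (i₁-moved : ¬ FixesBlock w i₁)
                   (only-i₀-i₁ : ∀ i → ¬ FixesBlock w i → i ≡ i₀ ⊎ i ≡ i₁) where
    open OrderTwo w w²-trivial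
    private
      f = fun w
      π = perm w ⟨$⟩ʳ_

    fixes-others : ∀ i → i ≢ i₀ → i ≢ i₁ → FixesBlock w i
    fixes-others i i≢i₀ i≢i₁ = decidable-stable (fixesBlock? w i) λ moved → [ i≢i₀ , i≢i₁ ]′ (only-i₀-i₁ i moved)

    by-cases : ∀ {P : Fin 9 → Set} → P i₀ → P i₁ → (∀ i → i ≢ i₀ → i ≢ i₁ → P i) → ∀ i → P i
    by-cases P₀ P₁ Pₒ i with i ≟ i₀ | i ≟ i₁
    ... | yes refl | _        = P₀
    ... | no _     | yes refl = P₁
    ... | no i≢i₀  | no i≢i₁  = Pₒ i i≢i₀ i≢i₁

    image-moved : ∀ i → π i ≢ i → ¬ FixesBlock w (π i)
    image-moved i πi≢i (ππi≡πi , _) = πi≢i (sym (trans (sym (π-involutive i)) ππi≡πi))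

    private
      σ-pair = two-point {j₀ = fz} {j₁ = fs fz} i₀≢i₁ (λ ())
      σ = proj₁ σ-pair
      σi₀ = proj₁ (proj₂ σ-pair)
      σi₁ = proj₂ (proj₂ σ-pair)

      σ-other₀ : ∀ i → i ≢ i₀ → σ ⟨$⟩ʳ i ≢ fz
      σ-other₀ i i≢i₀ σi≡0 = i≢i₀ (⟨$⟩ʳ-injective σ (trans σi≡0 (sym σi₀)))

      σ-other₁ : ∀ i → i ≢ i₁ → σ ⟨$⟩ʳ i ≢ fs fz
      σ-other₁ i i≢i₁ σi≡1 = i≢i₁ (⟨$⟩ʳ-injective σ (trans σi≡1 (sym σi₁)))

    both-fixed : π i₀ ≡ i₀ → ConjugateCyclic w b₀
    both-fixed πi₀≡i₀ = conjugateCyclic σ b₀ σπ≡b₀σ b₀-fixed (λ i πi≢i → contradiction (π-id i) πi≢i)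
      where
      πi₁≢i₀ : π i₁ ≢ i₀
      πi₁≢i₀ πi₁≡i₀ = i₀≢i₁ (sym (⟨$⟩ʳ-injective (perm w) (trans πi₁≡i₀ (sym πi₀≡i₀))))

      πi₁≡i₁ : π i₁ ≡ i₁
      πi₁≡i₁ = decidable-stable (π i₁ ≟ i₁) λ πi₁≢i₁ →
        [ πi₁≢i₀ , πi₁≢i₁ ]′ (only-i₀-i₁ (π i₁) (image-moved i₁ πi₁≢i₁))

      π-id : ∀ i → π i ≡ i
      π-id = by-cases πi₀≡i₀ πi₁≡i₁ (λ i i≢i₀ i≢i₁ → proj₁ (fixes-others i i≢i₀ i≢i₁))

      f≡3 : ∀ i → ¬ FixesBlock w i → f i ≡ # 3
      f≡3 i moved = hasOrder-2 (f i) (fixedBlock-hasOrder-2 i (π-id i) moved)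

      σπ≡b₀σ : ∀ i → σ ⟨$⟩ʳ π i ≡ perm b₀ ⟨$⟩ʳ (σ ⟨$⟩ʳ i)
      σπ≡b₀σ i = trans (cong (σ ⟨$⟩ʳ_) (π-id i)) (sym (b₀-perm (σ ⟨$⟩ʳ i)))

      b₀-fixed : ∀ i → π i ≡ i → fun b₀ (σ ⟨$⟩ʳ i) ≡ f i
      b₀-fixed = by-cases
        (λ _ → trans (cong (fun b₀) σi₀) (trans (proj₁ b₀-fun) (sym (f≡3 i₀ i₀-moved))))
        (λ _ → trans (cong (fun b₀) σi₁) (trans (proj₁ (proj₂ b₀-fun)) (sym (f≡3 i₁ i₁-moved))))
        (λ i i≢i₀ i≢i₁ _ → trans (proj₂ (proj₂ b₀-fun) (σ ⟨$⟩ʳ i) (σ-other₀ i i≢i₀) (σ-other₁ i i≢i₁))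
                                 (sym (proj₂ (fixes-others i i≢i₀ i≢i₁))))

    swapped : π i₀ ≢ i₀ → ConjugateCyclic w b₁
    swapped πi₀≢i₀ = conjugateCyclic σ b₁ σπ≡b₁σ
      (λ i πi≡i → trans (b₁-fun (σ ⟨$⟩ʳ i)) (sym (proj₂ (fixes-others i (i≢i₀ i πi≡i) (i≢i₁ i πi≡i)))))
      (λ i _ → b₁-fun (σ ⟨$⟩ʳ i))
      where
      open ≡-Reasoning
      swap = transpose fz (fs fz)

      πi₀≡i₁ : π i₀ ≡ i₁
      πi₀≡i₁ = [ (λ πi₀≡i₀ → contradiction πi₀≡i₀ πi₀≢i₀) , id ]′
                 (only-i₀-i₁ (π i₀) (image-moved i₀ πi₀≢i₀))

      πi₁≡i₀ : π i₁ ≡ i₀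
      πi₁≡i₀ = trans (cong π (sym πi₀≡i₁)) (π-involutive i₀)

      i≢i₀ : ∀ i → π i ≡ i → i ≢ i₀
      i≢i₀ i πi≡i refl = πi₀≢i₀ πi≡i

      i≢i₁ : ∀ i → π i ≡ i → i ≢ i₁
      i≢i₁ i πi≡i refl = i₀≢i₁ (trans (sym πi₁≡i₀) πi≡i)

      σπ≡b₁σ : ∀ i → σ ⟨$⟩ʳ π i ≡ perm b₁ ⟨$⟩ʳ (σ ⟨$⟩ʳ i)
      σπ≡b₁σ = by-cases
        (begin
          σ ⟨$⟩ʳ π i₀             ≡⟨ cong (σ ⟨$⟩ʳ_) πi₀≡i₁ ⟩
          σ ⟨$⟩ʳ i₁               ≡⟨ σi₁ ⟩
          fs fz                  ≡⟨ transpose-matchˡ fz (fs fz) ⟨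
          swap ⟨$⟩ʳ fz            ≡⟨ cong (swap ⟨$⟩ʳ_) σi₀ ⟨
          swap ⟨$⟩ʳ (σ ⟨$⟩ʳ i₀)    ≡⟨ b₁-perm (σ ⟨$⟩ʳ i₀) ⟨
          perm b₁ ⟨$⟩ʳ (σ ⟨$⟩ʳ i₀) ∎)
        (begin
          σ ⟨$⟩ʳ π i₁             ≡⟨ cong (σ ⟨$⟩ʳ_) πi₁≡i₀ ⟩
          σ ⟨$⟩ʳ i₀               ≡⟨ σi₀ ⟩
          fz                     ≡⟨ transpose-matchʳ fz (fs fz) ⟨
          swap ⟨$⟩ʳ fs fz         ≡⟨ cong (swap ⟨$⟩ʳ_) σi₁ ⟨
          swap ⟨$⟩ʳ (σ ⟨$⟩ʳ i₁)    ≡⟨ b₁-perm (σ ⟨$⟩ʳ i₁) ⟨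
          perm b₁ ⟨$⟩ʳ (σ ⟨$⟩ʳ i₁) ∎)
        (λ i i≢i₀ i≢i₁ → begin
          σ ⟨$⟩ʳ π i              ≡⟨ cong (σ ⟨$⟩ʳ_) (proj₁ (fixes-others i i≢i₀ i≢i₁)) ⟩
          σ ⟨$⟩ʳ i                ≡⟨ transpose-mismatch fz (fs fz) (σ ⟨$⟩ʳ i) (σ-other₀ i i≢i₀) (σ-other₁ i i≢i₁) ⟨
          swap ⟨$⟩ʳ (σ ⟨$⟩ʳ i)     ≡⟨ b₁-perm (σ ⟨$⟩ʳ i) ⟨
          perm b₁ ⟨$⟩ʳ (σ ⟨$⟩ʳ i)  ∎)

    classify : ConjugateCyclic w b₀ ⊎ ConjugateCyclic w b₁
    classify with π i₀ ≟ i₀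
    ... | yes πi₀≡i₀ = inj₁ (both-fixed πi₀≡i₀)
    ... | no πi₀≢i₀  = inj₂ (swapped πi₀≢i₀)

  γ-perm : ∀ j y → perm (γ j) ⟨$⟩ʳ y ≡ standardInvolution (toℕ j) y
  γ-perm = from-yes (FP.all? λ j → FP.all? λ y → perm (γ j) ⟨$⟩ʳ y ≟ standardInvolution (toℕ j) y)

  γ-fun-fixed : ∀ j y → standardInvolution (toℕ j) y ≡ y → fun (γ j) y ≡ # 3
  γ-fun-fixed = from-yes (FP.all? λ j → FP.all? λ y → (standardInvolution (toℕ j) y ≟ y) →-dec (fun (γ j) y ≟ # 3))

  γ-fun-moved : ∀ j y → standardInvolution (toℕ j) y ≢ y → fun (γ j) y ≡ zeroZ
  γ-fun-moved = from-yes (FP.all? λ j → FP.all? λ y → ¬? (standardInvolution (toℕ j) y ≟ y) →-dec (fun (γ j) y ≟ zeroZ))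

  module NineBlocks (w : 𝒲) (cycleType : HasCycleType w 2 27) where
    open OrderTwo w (hasCycleType⇒act-^≡id {b = 27} cycleType)
    private
      π = perm w ⟨$⟩ʳ_

    all-moved : ∀ i → ¬ FixesBlock w i
    all-moved = count≡m⇒all (¬? ∘ fixesBlock? w) (hasCycleType⇒movedBlocks {b = 27} 9 cycleType refl)

    conjugateCyclic-γ : NormalForm π → Σ[ j ∈ Fin 5 ] ConjugateCyclic w (γ j)
    conjugateCyclic-γ (j , σ , σπ≡std∘σ) = j , conjugateCyclic σ (γ j) σπ≡γσ γ-fixed γ-moved
      where
      σπ≡γσ : ∀ i → σ ⟨$⟩ʳ π i ≡ perm (γ j) ⟨$⟩ʳ (σ ⟨$⟩ʳ i)
      σπ≡γσ i = trans (σπ≡std∘σ i) (sym (γ-perm j (σ ⟨$⟩ʳ i)))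
      γ-fixed : ∀ i → π i ≡ i → fun (γ j) (σ ⟨$⟩ʳ i) ≡ fun w i
      γ-fixed i πi≡i = trans (γ-fun-fixed j (σ ⟨$⟩ʳ i) (trans (sym (σπ≡std∘σ i)) (cong (σ ⟨$⟩ʳ_) πi≡i)))
                             (sym (hasOrder-2 (fun w i) (fixedBlock-hasOrder-2 i πi≡i (all-moved i))))
      γ-moved : ∀ i → π i ≢ i → fun (γ j) (σ ⟨$⟩ʳ i) ≡ zeroZ
      γ-moved i πi≢i = γ-fun-moved j (σ ⟨$⟩ʳ i) (λ std≡ → πi≢i (⟨$⟩ʳ-injective σ (trans (σπ≡std∘σ i) std≡)))

    classify : Σ[ j ∈ Fin 5 ] ConjugateCyclic w (γ j)
    classify = conjugateCyclic-γ (normalForm π π-involutive)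

  classify-2-27 : ∀ w → HasCycleType w 2 27 → Σ[ j ∈ Fin 5 ] ConjugateCyclic w (γ j)
  classify-2-27 = NineBlocks.classify

  classify-2-6 : ∀ w → HasCycleType w 2 6 → ConjugateCyclic w b₀ ⊎ ConjugateCyclic w b₁
  classify-2-6 w cycleType with count≡2⇒pair (¬? ∘ fixesBlock? w) (hasCycleType⇒movedBlocks {b = 6} 2 cycleType refl)
  ... | _ , _ , i₀≢i₁ , i₀-moved , i₁-moved , only-i₀-i₁ =
    TwoBlocks.classify w (hasCycleType⇒act-^≡id {b = 6} cycleType) i₀≢i₁ i₀-moved i₁-moved only-i₀-i₁

  classify-2-3 : ∀ w → HasCycleType w 2 3 → ConjugateCyclic w c
  classify-2-3 w cycleType = singleBlock-conjugateCyclic {b = 3} c cycleType refl c-generators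

  classify-3-2 : ∀ w → HasCycleType w 3 2 → ConjugateCyclic w d
  classify-3-2 w cycleType = singleBlock-conjugateCyclic {b = 2} d cycleType refl d-generators

  classify-6-1 : ∀ w → HasCycleType w 6 1 → ConjugateCyclic w e
  classify-6-1 w cycleType = singleBlock-conjugateCyclic {b = 1} e cycleType refl e-generators

open WreathProductOfOrder6On9 using (classify-2-27; classify-2-6; classify-2-3; classify-3-2; classify-6-1)

lemma6p7 : (∀ (w : 𝒲) → HasCycleType w 2 27 → Σ[ j ∈ Fin 5 ] ConjugateCyclic w (γ j))
           × (∀ (w : 𝒲) → HasCycleType w 2 6 → ConjugateCyclic w b₀ ⊎ ConjugateCyclic w b₁)
           × (∀ (w : 𝒲) → HasCycleType w 2 3 → ConjugateCyclic w c)
           × (∀ (w : 𝒲) → HasCycleType w 3 2 → ConjugateCyclic w d)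
           × (∀ (w : 𝒲) → HasCycleType w 6 1 → ConjugateCyclic w e)
lemma6p7 = classify-2-27 , classify-2-6 , classify-2-3 , classify-3-2 , classify-6-1
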